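{- For every term rewriting system $\mathcal{R}$ the following inclusions hold: (1) $\twoheadrightarrow^{\infty}\subseteq\stackrel{\infty}{\to}$; (2) $\twoheadrightarrow^{\infty}\subseteq\big((\twoheadrightarrow^{\infty})^{ -1}\cup\twoheadrightarrow^{\infty}\big)^*$; (3) $\stackrel{\infty}{\to}\subseteq\big((\stackrel{\infty}{\to})^{ -1}\cup\stackrel{\infty}{\to}\big)^*$; (4) $\big((\twoheadrightarrow^{\infty})^{ -1}\cup\twoheadrightarrow^{\infty}\big)^*\subseteq\big((\stackrel{\infty}{\to})^{ -1}\cup\stackrel{\infty}{\to}\big)^*$; (5) $\big((\stackrel{\infty}{\to})^{ -1}\cup\stackrel{\infty}{\to}\big)^*\subseteq\stackrel{\infty}{=}$. Moreover, for each of these five inclusions there exists a term rewriting system for which the inclusion is strict.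
   Context: Fix a signature $\Sigma$ and an infinite set $\mathcal{X}$ of variables disjoint from $\Sigma$; $T$ is the set of finite and infinite terms over $\Sigma$ and $\mathcal{X}$. A term rewriting system $\mathcal{R}$ is a set of rules $\ell\to r$ with $\ell,r\in T$, $\ell\notin\mathcal{X}$, variables of $r$ occurring in $\ell$. Root steps: $\to_\varepsilon=\{(\ell\sigma,r\sigma)\mid\ell\to r\in\mathcal{R},\ \sigma:\mathcal{X}\to T\}$, with inverse $\leftarrow_\varepsilon$. For $R\subseteq T\times T$, $\underline{R}=\{(f(s_1,\dots,s_n),f(t_1,\dots,t_n))\mid f\in\Sigma,\ \mathrm{ar}(f)=n,\ s_iRt_i\}\cup\mathrm{id}$; $R^{ -1}$ is the inverse relation, $;$ diagrammatic composition, $^*$ reflexive-transitive closure, $\mu,\nu$ least/greatest fixed points on the lattice of relations on $T$. Define $\twoheadrightarrow^{\infty}=\mu R.\,\nu S.\,(\to_\varepsilon\cup\underline{R})^*;\underline{S}$ (infinitary rewriting), $\stackrel{\infty}{\to}=\nu R.\,(\to_\varepsilon\cup\underline{R})^*$ (bi-infinite rewriting), $\stackrel{\infty}{=}=\nu R.\,(\leftarrow_\varepsilon\cup\to_\varepsilon\cup\underline{R})^*$ (infinitary equational reasoning). -}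

module Defs where

open import Level using (Level; 0ℓ; _⊔_) renaming (suc to lsuc)
open import Data.Nat using (ℕ; _<_)
open import Data.List using (List; []; _∷_; _∷ʳ_)
open import Data.Maybe using (Maybe; just; nothing)
open import Data.Product using (Σ; Σ-syntax; ∃; ∃-syntax; _×_; _,_; proj₁; proj₂)
open import Data.Sum using (_⊎_; inj₁; inj₂)
open import Relation.Nullary using (¬_)
open import Relation.Binary.PropositionalEquality using (_≡_)
open import Relation.Binary.Core using (Rel; _⇒_)
open import Relation.Binary.Construct.Union using (_∪_)
open import Relation.Binary.Construct.Closure.ReflexiveTransitive using (Star)
open import Function using (flip; _∘_)
open import Function.Definitions using (Injective)

1ℓ 2ℓ : Level
1ℓ = lsuc 0ℓ
2ℓ = lsuc 1ℓ

private
  variable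
    a b : Level

infixr 9 _⨾_
_⨾_ : {A : Set} → Rel A a → Rel A b → Rel A (a ⊔ b)
(P ⨾ Q) s t = ∃[ u ] (P s u × Q u t)

ν : {A : Set} → (Rel A a → Rel A b) → Rel A (lsuc a ⊔ b)
ν {a = a} {A = A} F s t = Σ[ S ∈ Rel A a ] ((S ⇒ F S) × S s t)

μ : {A : Set} → (Rel A a → Rel A b) → Rel A (lsuc a ⊔ b)
μ {a = a} {A = A} F s t = (R : Rel A a) → (F R ⇒ R) → R s t

Sym* : {A : Set} → Rel A a → Rel A a
Sym* P = Star (flip P ∪ P)

_⊂_ : {A : Set} → Rel A a → Rel A b → Set _
P ⊂ Q = (P ⇒ Q) × ∃[ s ] ∃[ t ] (Q s t × ¬ P s t)

record Signature : Set₁ where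
  field
    Sym : Set
    ar  : Sym → ℕ

Infinite : Set → Set
Infinite X = Σ (ℕ → X) (Injective _≡_ _≡_)

module Terms (Sig : Signature) (X : Set) where
  open Signature Sig

  -- positions: finite sequences of argument indices, root first
  Pos : Set
  Pos = List ℕ

  Label : Set
  Label = X ⊎ Sym

  Lab : Set
  Lab = Pos → Maybe Label

  -- A term is a partial labelling of positions whose domain is a tree:
  -- the root is labelled, and p·i is labelled iff p is labelled by a
  -- function symbol f with i < ar(f).  (Variables are thus leaves.)
  record T : Set where
    field
      lab      : Lab
      wf-root  : ∃[ c ] (lab [] ≡ just c)
      wf-child : ∀ p i →
                   ((∃[ c ] (lab (p ∷ʳ i) ≡ just c)) →
                      ∃[ f ] (lab p ≡ just (inj₂ f) × i < ar f))
                 × ((∃[ f ] (lab p ≡ just (inj₂ f) × i < ar f)) →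
                      ∃[ c ] (lab (p ∷ʳ i) ≡ just c))
  open T public

  _≐_ : Rel T 0ℓ
  s ≐ t = ∀ p → lab s p ≡ lab t p

  child : (t : T) (f : Sym) → lab t [] ≡ just (inj₂ f) → (i : ℕ) → i < ar f → T
  lab (child t f eq i lt) q = lab t (i ∷ q)
  wf-root (child t f eq i lt) = proj₂ (wf-child t [] i) (f , eq , lt)
  wf-child (child t f eq i lt) p j = wf-child t (i ∷ p) j

  subL : (X → T) → Lab → Lab
  subL σ l p with l []
  ... | just (inj₁ x) = lab (σ x) p
  ... | _ = go p
    where
    go : Pos → Maybe Label
    go []      = l []
    go (i ∷ q) = subL σ (l ∘ (i ∷_)) q

  Occurs : X → T → Set
  Occurs x t = ∃[ p ] (lab t p ≡ just (inj₁ x))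

  record TRS : Set₁ where
    field
      _⟶_        : T → T → Set
      lhs-nonvar : ∀ {ℓ r} → ℓ ⟶ r → ∀ x → ¬ (lab ℓ [] ≡ just (inj₁ x))
      var-cond   : ∀ {ℓ r} → ℓ ⟶ r → ∀ x → Occurs x r → Occurs x ℓ

  Under : Rel T a → Rel T a
  Under {a = a} R s t =
      (∃[ f ] Σ[ es ∈ lab s [] ≡ just (inj₂ f) ] Σ[ et ∈ lab t [] ≡ just (inj₂ f) ]
         (∀ i (lt : i < ar f) → R (child s f es i lt) (child t f et i lt)))
    ⊎ Level.Lift a (s ≐ t)

  module Rewriting (𝓡 : TRS) where
    open TRS 𝓡

    _→ε_ : Rel T 0ℓ
    s →ε t = ∃[ ℓ ] ∃[ r ] ∃[ σ ]
               (ℓ ⟶ r × (∀ p → lab s p ≡ subL σ (lab ℓ) p)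
                      × (∀ p → lab t p ≡ subL σ (lab r) p))

    _←ε_ : Rel T 0ℓ
    _←ε_ = flip _→ε_

    _↠∞_ : Rel T 2ℓ
    _↠∞_ = μ {a = 1ℓ} (λ R → ν {a = 0ℓ} (λ S → Star (_→ε_ ∪ Under R) ⨾ Under S))

    _∞→_ : Rel T 1ℓ
    _∞→_ = ν {a = 0ℓ} (λ R → Star (_→ε_ ∪ Under R))

    _∞=_ : Rel T 1ℓ
    _∞=_ = ν {a = 0ℓ} (λ R → Star (_←ε_ ∪ _→ε_ ∪ Under R))

-- (1) is ↠∞'s least-fixed-point induction: a ν-layer of steps (→ε ∪ R̲)* whose argument steps
-- are ∞→-related is itself contained in ∞→, because the post-fixed points witnessing the
-- ∞→-proofs inside it form a small family whose union, together with the layer, is again a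
-- post-fixed point. (2)-(4) are immediate, and (5) holds because the symmetric closure of a
-- post-fixed point of (→ε ∪ R̲)* is a post-fixed point of (←ε ∪ →ε ∪ R̲)*.
--
-- For f(b) → b we have fω ∞→ b, while ↠∞ preserves and reflects containing b
-- (by induction on the depth of an occurrence) and fω contains no b; this separates (1) and (4).
-- For the zigzag rules z_{e i}(x) → z_{o i}(x) ← z_{e (i+1)}(x), the one-step reduction
-- z_{e 0}(t) → z_{o 0}(t) cannot be reversed even by ∞→, separating (2) and (3). Finally
-- z_{e 0}^ω ∞= z_{w 0}(z_{w 1}(…)), where w n is the n-th node of the zigzag e 0, o 0, e 1, …,
-- since each position may take its own number of zigzag steps; but a ∞→-step moves every label
-- at most one node along the zigzag, so no finite chain of ∞→-steps in either direction
-- connects the two terms.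
module Submission where

open import Defs
open import Level using (Level; Lift; lift; lower; 0ℓ; _⊔_) renaming (suc to lsuc)
open import Data.Empty using (⊥; ⊥-elim)
open import Data.Unit using (⊤; tt)
open import Data.Nat using (ℕ; zero; suc; _+_; _<_; _≤_; z≤n; s≤s; _<?_; ∣_-_∣)
open import Data.Nat.Properties using (n≮0; 1+n≢0; ≤-refl; ≤-reflexive; ∣n-n∣≡0; 1+n≰n; +-suc; +-identityʳ; +-mono-≤; ≤-trans; ∣-∣-comm; ∣-∣-triangle)
open import Data.Nat.GeneralisedArithmetic using (iterate)
open import Data.List using ([]; _∷_; _∷ʳ_; _++_; length; replicate)
open import Data.List.Properties using (++-identityʳ; ++-assoc)
open import Data.Maybe using (Maybe; just; nothing)
open import Data.Product using (Σ-syntax; ∃-syntax; _×_; _,_; proj₁; proj₂)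
open import Data.Sum using (_⊎_; inj₁; inj₂; [_,_])
open import Function using (flip; _∘_; id; const)
open import Relation.Nullary using (¬_; yes; no)
open import Relation.Binary.Core using (Rel; _⇒_)
open import Relation.Binary.Definitions using (Reflexive; Transitive)
open import Relation.Binary.Construct.Union using (_∪_)
open import Relation.Binary.Construct.Closure.ReflexiveTransitive as Star
  using (Star; ε; _◅_; _◅◅_; return; reverse; _⋆)
open import Relation.Binary.Construct.Closure.ReflexiveTransitive.Properties using (module StarReasoning)
open import Relation.Binary.PropositionalEquality using (_≡_; _≢_; refl; sym; trans; cong; cong₂; subst; subst₂; module ≡-Reasoning)

private
  variable
    ℓ₁ ℓ₂ ℓ₃ : Level

Monotone : {A : Set} → (Rel A ℓ₁ → Rel A ℓ₂) → Set (lsuc ℓ₁ ⊔ ℓ₂)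
Monotone F = ∀ {P Q} → P ⇒ Q → F P ⇒ F Q

Sym*-return : {A : Set} {P : Rel A ℓ₁} → P ⇒ Sym* P
Sym*-return p = return (inj₂ p)

Sym*-mono : {A : Set} {P : Rel A ℓ₁} {Q : Rel A ℓ₂} → P ⇒ Q → Sym* P ⇒ Sym* Q
Sym*-mono g = Star.map λ { (inj₁ p) → inj₁ (g p) ; (inj₂ p) → inj₂ (g p) }

module _ {A : Set} (F : Rel A 0ℓ → Rel A ℓ₂) where

  PostFixed : Set (1ℓ ⊔ ℓ₂)
  PostFixed = Σ[ S ∈ Rel A 0ℓ ] (S ⇒ F S)

  ⋃ : {I : Set} → (I → PostFixed) → Rel A 0ℓ
  ⋃ W x y = ∃[ i ] proj₁ (W i) x y

  -- ν F lives one universe level above its witnesses, so it cannot serve as a witness itself;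
  -- a proof of G (ν F) x y can instead be rebuilt over a small union of witnesses.
  Witnessed : (Rel A 0ℓ → Rel A ℓ₃) → Rel A (1ℓ ⊔ ℓ₂ ⊔ ℓ₃)
  Witnessed G x y = Σ[ I ∈ Set ] Σ[ W ∈ (I → PostFixed) ] G (⋃ W) x y

  ⋃-postFixed : Monotone F → {I : Set} (W : I → PostFixed) → ⋃ W ⇒ F (⋃ W)
  ⋃-postFixed mono W (i , s) = mono (i ,_) (proj₂ (W i) s)

  ν⇒Witnessed : ν F ⇒ Witnessed id
  ν⇒Witnessed (S , post , s) = ⊤ , const (S , post) , tt , s

  Star-Witnessed : {G : Rel A 0ℓ → Rel A ℓ₃} → Monotone G → Star (Witnessed G) ⇒ Witnessed (Star ∘ G)
  Star-Witnessed mono ε = ⊥ , ⊥-elim , ε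
  Star-Witnessed mono ((I , W , g) ◅ gs) with Star-Witnessed mono gs
  ... | J , V , gs′ =
    (I ⊎ J) , [ W , V ] , mono (λ { (i , s) → inj₁ i , s }) g ◅ Star.map (mono (λ { (j , s) → inj₂ j , s })) gs′

module TermProperties (Sig : Signature) (X : Set) where
  open Signature Sig
  open Terms Sig X

  ⌜_⌝ : Sym → Maybe Label
  ⌜ f ⌝ = just (inj₂ f)

  Defined : Maybe Label → Set
  Defined m = ∃[ c ] (m ≡ just c)

  WellFormed : Lab → Set
  WellFormed l = ∀ p i → (Defined (l (p ∷ʳ i)) → ∃[ f ] (l p ≡ ⌜ f ⌝ × i < ar f))
                       × (∃[ f ] (l p ≡ ⌜ f ⌝ × i < ar f) → Defined (l (p ∷ʳ i)))

  below-unary : ∀ {f i} → ar f ≡ 1 → i < ar f → i ≡ 0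
  below-unary ar≡1 i<ar with subst (_ <_) ar≡1 i<ar
  ... | s≤s z≤n = refl

  0<unary : ∀ {f} → ar f ≡ 1 → 0 < ar f
  0<unary ar≡1 = subst (0 <_) (sym ar≡1) (s≤s z≤n)

  leafLab : Label → Lab
  leafLab c []      = just c
  leafLab c (_ ∷ _) = nothing

  unaryLab : Sym → Lab → Lab
  unaryLab f l []          = ⌜ f ⌝
  unaryLab f l (zero ∷ q)  = l q
  unaryLab f l (suc _ ∷ _) = nothing

  var : X → T
  lab (var x) = leafLab (inj₁ x)
  wf-root (var x) = _ , refl
  wf-child (var x) []      i = (λ { (_ , ()) }) , λ { (_ , () , _) }
  wf-child (var x) (_ ∷ _) i = (λ { (_ , ()) }) , λ { (_ , () , _) }

  constant : (f : Sym) → ar f ≡ 0 → T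
  lab (constant f _) = leafLab (inj₂ f)
  wf-root (constant f _) = _ , refl
  wf-child (constant f ar≡0) [] i = (λ { (_ , ()) }) , λ { (_ , refl , i<ar) → ⊥-elim (n≮0 (subst (i <_) ar≡0 i<ar)) }
  wf-child (constant f _) (_ ∷ _) i = (λ { (_ , ()) }) , λ { (_ , () , _) }

  unary : (f : Sym) → ar f ≡ 1 → T → T
  lab (unary f _ t) = unaryLab f (lab t)
  wf-root (unary f _ t) = _ , refl
  wf-child (unary f ar≡1 t) [] zero    = (λ _ → f , refl , 0<unary ar≡1) , λ _ → wf-root t
  wf-child (unary f ar≡1 t) [] (suc i) = (λ { (_ , ()) }) , λ { (_ , refl , i<ar) → ⊥-elim (1+n≢0 (below-unary ar≡1 i<ar)) }
  wf-child (unary f _ t) (zero ∷ p) i  = wf-child t p i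
  wf-child (unary f _ t) (suc _ ∷ p) i = (λ { (_ , ()) }) , λ { (_ , () , _) }

  module _ {A : Set} (next : A → A) (sym-at : A → Sym) (unary-at : ∀ a → ar (sym-at a) ≡ 1) where

    unfoldLab : A → Lab
    unfoldLab a []          = ⌜ sym-at a ⌝
    unfoldLab a (zero ∷ q)  = unfoldLab (next a) q
    unfoldLab a (suc _ ∷ _) = nothing

    unfoldLab-wf : ∀ a → WellFormed (unfoldLab a)
    unfoldLab-wf a [] zero    = (λ _ → _ , refl , 0<unary (unary-at a)) , λ _ → _ , refl
    unfoldLab-wf a [] (suc i) = (λ { (_ , ()) }) , λ { (_ , refl , i<ar) → ⊥-elim (1+n≢0 (below-unary (unary-at a) i<ar)) }
    unfoldLab-wf a (zero ∷ p) i  = unfoldLab-wf (next a) p i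
    unfoldLab-wf a (suc _ ∷ p) i = (λ { (_ , ()) }) , λ { (_ , () , _) }

    unfold : A → T
    lab (unfold a) = unfoldLab a
    wf-root (unfold a) = _ , refl
    wf-child (unfold a) = unfoldLab-wf a

    unfold-unary : ∀ a → unfold a ≐ unary (sym-at a) (unary-at a) (unfold (next a))
    unfold-unary a []          = refl
    unfold-unary a (zero ∷ q)  = refl
    unfold-unary a (suc _ ∷ q) = refl

    unfold-spine : ∀ a n → lab (unfold a) (replicate n 0) ≡ ⌜ sym-at (iterate next a n) ⌝
    unfold-spine a zero    = refl
    unfold-spine a (suc n) = unfold-spine (next a) n

  unaryLab-cong : ∀ f {l l′} → (∀ q → l q ≡ l′ q) → ∀ p → unaryLab f l p ≡ unaryLab f l′ p
  unaryLab-cong f l≗l′ []          = refl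
  unaryLab-cong f l≗l′ (zero ∷ q)  = l≗l′ q
  unaryLab-cong f l≗l′ (suc _ ∷ q) = refl

  subL-empty : ∀ σ l → (∀ p → l p ≡ nothing) → ∀ q → subL σ l q ≡ nothing
  subL-empty σ l empty q with l [] in eq
  ... | just _ with () ← trans (sym eq) (empty [])
  subL-empty σ l empty []      | nothing = eq
  subL-empty σ l empty (i ∷ q) | nothing = subL-empty σ (l ∘ (i ∷_)) (empty ∘ (i ∷_)) q

  subL-constant : ∀ σ f p → subL σ (leafLab (inj₂ f)) p ≡ leafLab (inj₂ f) p
  subL-constant σ f []      = refl
  subL-constant σ f (i ∷ q) = subL-empty σ (λ _ → nothing) (λ _ → refl) q

  subL-unary : ∀ σ f l p → subL σ (unaryLab f l) p ≡ unaryLab f (subL σ l) p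
  subL-unary σ f l []          = refl
  subL-unary σ f l (zero ∷ q)  = refl
  subL-unary σ f l (suc _ ∷ q) = subL-empty σ (λ _ → nothing) (λ _ → refl) q

  prefix-defined : (t : T) (p q : Pos) → Defined (lab t (p ++ q)) → Defined (lab t p)
  prefix-defined t p []      d = subst (Defined ∘ lab t) (++-identityʳ p) d
  prefix-defined t p (i ∷ q) d
    with proj₁ (wf-child t p i)
           (prefix-defined t (p ∷ʳ i) q (subst (Defined ∘ lab t) (sym (++-assoc p (i ∷ []) q)) d))
  ... | f , eq , _ = inj₂ f , eq

  no-argument-beyond-arity : (t : T) {f : Sym} → lab t [] ≡ ⌜ f ⌝ → ∀ i q → ¬ i < ar f → lab t (i ∷ q) ≡ nothing
  no-argument-beyond-arity t root i q i≮ar with lab t (i ∷ q) in eq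
  ... | nothing = refl
  ... | just c with proj₁ (wf-child t [] i) (prefix-defined t (i ∷ []) q (c , eq))
  ...   | _ , root′ , i<ar with trans (sym root) root′
  ...     | refl = ⊥-elim (i≮ar i<ar)

  Under-map : {P : Rel T ℓ₁} {Q : Rel T ℓ₂} → P ⇒ Q → Under P ⇒ Under Q
  Under-map g (inj₁ (f , es , et , h)) = inj₁ (f , es , et , λ i lt → g (h i lt))
  Under-map g (inj₂ (lift e))          = inj₂ (lift e)

  Under-flip : {P : Rel T ℓ₁} {x y : T} → Under P x y → Under (flip P) y x
  Under-flip (inj₁ (f , es , et , h)) = inj₁ (f , et , es , h)
  Under-flip (inj₂ (lift e))          = inj₂ (lift (sym ∘ e))

  Under-root : {Q : Rel T ℓ₁} {x y : T} → Under Q x y → lab x [] ≡ lab y []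
  Under-root (inj₁ (f , es , et , _)) = trans es (sym et)
  Under-root (inj₂ (lift e))          = e []

  ArgumentsRelated : Rel T ℓ₁ → T → T → ℕ → Set ℓ₁
  ArgumentsRelated Q x y i =
    ∃[ f ] Σ[ es ∈ lab x [] ≡ ⌜ f ⌝ ] Σ[ et ∈ lab y [] ≡ ⌜ f ⌝ ] Σ[ lt ∈ i < ar f ]
      Q (child x f es i lt) (child y f et i lt)

  Under-argument : {Q : Rel T ℓ₁} {x y : T} → Under Q x y → ∀ i q →
                   lab x (i ∷ q) ≡ lab y (i ∷ q) ⊎ ArgumentsRelated Q x y i
  Under-argument (inj₂ (lift e)) i q = inj₁ (e (i ∷ q))
  Under-argument {x = x} {y} (inj₁ (f , es , et , h)) i q with i <? ar f
  ... | yes i<ar = inj₂ (f , es , et , i<ar , h i i<ar)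
  ... | no  i≮ar = inj₁ (trans (no-argument-beyond-arity x es i q i≮ar)
                               (sym (no-argument-beyond-arity y et i q i≮ar)))

  module _ (c : Maybe Label) where

    Contains : T → Set
    Contains t = ∃[ p ] (lab t p ≡ c)

    ContainsWithin : ℕ → T → Set
    ContainsWithin n t = ∃[ p ] (length p ≤ n × lab t p ≡ c)

    Under-within₀ : {Q : Rel T ℓ₁} {x y : T} → Under Q x y → ContainsWithin 0 x → ContainsWithin 0 y
    Under-within₀ {Q = Q} {x} {y} u ([] , _ , hp) = [] , z≤n , trans (sym (Under-root {Q = Q} {x} {y} u)) hp

    Under-within : ∀ {n} {Q : Rel T ℓ₁} → (∀ {x y} → Q x y → ContainsWithin n x → ContainsWithin n y) →
                   ∀ {x y} → Under Q x y → ContainsWithin (suc n) x → ContainsWithin (suc n) y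
    Under-within {Q = Q} hyp {x} {y} u ([] , _ , hp) = [] , z≤n , trans (sym (Under-root {Q = Q} {x} {y} u)) hp
    Under-within {Q = Q} hyp {x} {y} u (i ∷ q , s≤s len , hp) with Under-argument {Q = Q} {x} {y} u i q
    ... | inj₁ eq = i ∷ q , s≤s len , trans (sym eq) hp
    ... | inj₂ (_ , _ , _ , _ , r) with hyp r (q , len , hp)
    ...   | q′ , len′ , hp′ = i ∷ q′ , s≤s len′ , hp′

    Under-within₀⁻¹ : {Q : Rel T ℓ₁} {x y : T} → Under Q x y → ContainsWithin 0 y → Contains x
    Under-within₀⁻¹ {Q = Q} {x} {y} u ([] , _ , hp) = [] , trans (Under-root {Q = Q} {x} {y} u) hp

    Under-within⁻¹ : ∀ {n} {Q : Rel T ℓ₁} → (∀ {x y} → Q x y → ContainsWithin n y → Contains x) →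
                     ∀ {x y} → Under Q x y → ContainsWithin (suc n) y → Contains x
    Under-within⁻¹ {Q = Q} hyp {x} {y} u ([] , _ , hp) = [] , trans (Under-root {Q = Q} {x} {y} u) hp
    Under-within⁻¹ {Q = Q} hyp {x} {y} u (i ∷ q , s≤s len , hp) with Under-argument {Q = Q} {x} {y} u i q
    ... | inj₁ eq = i ∷ q , trans eq hp
    ... | inj₂ (_ , _ , _ , _ , r) with hyp r (q , len , hp)
    ...   | q′ , hp′ = i ∷ q′ , hp′

    Under-contains⁻¹ : {Q : Rel T ℓ₁} → (∀ {x y} → Q x y → Contains y → Contains x) →
                       ∀ {x y} → Under Q x y → Contains y → Contains x
    Under-contains⁻¹ {Q = Q} hyp {x} {y} u ([] , hp) = [] , trans (Under-root {Q = Q} {x} {y} u) hp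
    Under-contains⁻¹ {Q = Q} hyp {x} {y} u (i ∷ q , hp) with Under-argument {Q = Q} {x} {y} u i q
    ... | inj₁ eq = i ∷ q , trans eq hp
    ... | inj₂ (_ , _ , _ , _ , r) with hyp r (q , hp)
    ...   | q′ , hp′ = i ∷ q′ , hp′

  Under-Witnessed : {F : Rel T 0ℓ → Rel T ℓ₂} {x y : T} → Under (Witnessed F id) x y → Witnessed F Under x y
  Under-Witnessed (inj₁ (f , es , et , h)) =
    (Σ[ i ∈ ℕ ] Σ[ lt ∈ i < ar f ] proj₁ (h i lt)) ,
    (λ (i , lt , j) → proj₁ (proj₂ (h i lt)) j) ,
    inj₁ (f , es , et , λ i lt → let _ , _ , j , w = h i lt in (i , lt , j) , w)
  Under-Witnessed (inj₂ (lift e)) = ⊥ , ⊥-elim , inj₂ (lift e)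

  module Infinitary (𝓡 : TRS) where
    open Rewriting 𝓡

    Steps : Rel T ℓ₁ → Rel T ℓ₁
    Steps R = Star (_→ε_ ∪ Under R)

    step-mono : {P Q : Rel T ℓ₁} → P ⇒ Q → (_→ε_ ∪ Under P) ⇒ (_→ε_ ∪ Under Q)
    step-mono g (inj₁ r) = inj₁ r
    step-mono {P = P} {Q} g {x} {y} (inj₂ u) = inj₂ (Under-map {P = P} {Q} g {x} {y} u)

    Steps-mono : Monotone (Steps {ℓ₁})
    Steps-mono {P = P} {Q} g = Star.map (λ {x} {y} → step-mono {P = P} {Q} g {x} {y})

    Steps-Witnessed : Steps _∞→_ ⇒ Witnessed Steps Steps
    Steps-Witnessed =
      Star-Witnessed Steps {G = λ R → _→ε_ ∪ Under R} step-mono ∘ Star.map (λ {x} {y} → step {x} {y})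
      where
      step : (_→ε_ ∪ Under _∞→_) ⇒ Witnessed Steps (λ R → _→ε_ ∪ Under R)
      step (inj₁ r) = ⊥ , ⊥-elim , inj₁ r
      step {x} {y} (inj₂ u) =
        let I , W , u′ = Under-Witnessed {F = Steps} {x} {y}
                           (Under-map {P = _∞→_} (ν⇒Witnessed Steps) {x} {y} u)
        in I , W , inj₂ u′

    ↠∞⇒∞→ : _↠∞_ ⇒ _∞→_
    ↠∞⇒∞→ h = h _∞→_ layer⇒∞→
      where
      layer⇒∞→ : ν (λ S → Steps _∞→_ ⨾ Under S) ⇒ _∞→_
      layer⇒∞→ (S , post , s) = S ∪ ⋃ Steps V , post′ , inj₁ s
        where
        witness : ∀ {x y} (h : S x y) → Witnessed Steps Steps x (proj₁ (post h))
        witness h = Steps-Witnessed (proj₁ (proj₂ (post h)))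
        V : (Σ[ x ∈ T ] Σ[ y ∈ T ] Σ[ h ∈ S x y ] proj₁ (witness h)) → PostFixed Steps
        V (_ , _ , h , i) = proj₁ (proj₂ (witness h)) i
        post′ : S ∪ ⋃ Steps V ⇒ Steps (S ∪ ⋃ Steps V)
        post′ {x} {y} (inj₁ h) =
          Steps-mono {P = ⋃ Steps (proj₁ (proj₂ (witness h)))} {S ∪ ⋃ Steps V}
            (λ { (i , w) → inj₂ ((x , y , h , i) , w) }) (proj₂ (proj₂ (witness h)))
          ◅◅ return (inj₂ (Under-map {P = S} {S ∪ ⋃ Steps V} inj₁ {proj₁ (post h)} {y}
                                     (proj₂ (proj₂ (post h)))))
        post′ (inj₂ v) = Steps-mono {P = ⋃ Steps V} {S ∪ ⋃ Steps V} inj₂ (⋃-postFixed Steps Steps-mono V v)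

    Sym*-Witnessed : Sym* _∞→_ ⇒ Witnessed Steps Sym*
    Sym*-Witnessed = Star-Witnessed Steps mono ∘ Star.map step
      where
      mono : Monotone (λ R → flip R ∪ R)
      mono g (inj₁ r) = inj₁ (g r)
      mono g (inj₂ r) = inj₂ (g r)
      step : (flip _∞→_ ∪ _∞→_) ⇒ Witnessed Steps (λ R → flip R ∪ R)
      step (inj₁ h) = let I , W , w = ν⇒Witnessed Steps h in I , W , inj₁ w
      step (inj₂ h) = let I , W , w = ν⇒Witnessed Steps h in I , W , inj₂ w

    EqSteps : Rel T ℓ₁ → Rel T ℓ₁
    EqSteps R = Star (_←ε_ ∪ _→ε_ ∪ Under R)

    Sym*-postFixed : {U : Rel T 0ℓ} → U ⇒ Steps U → Sym* U ⇒ EqSteps (Sym* U)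
    Sym*-postFixed {U} post = step ⋆
      where
      forward : (_→ε_ ∪ Under U) ⇒ (_←ε_ ∪ _→ε_ ∪ Under (Sym* U))
      forward (inj₁ r) = inj₂ (inj₁ r)
      forward {x} {y} (inj₂ u) = inj₂ (inj₂ (Under-map {P = U} {Sym* U} (return ∘ inj₂) {x} {y} u))
      backward : ∀ {x y} → (_→ε_ ∪ Under U) x y → (_←ε_ ∪ _→ε_ ∪ Under (Sym* U)) y x
      backward (inj₁ r) = inj₁ r
      backward {x} {y} (inj₂ u) =
        inj₂ (inj₂ (Under-flip {P = flip (Sym* U)} {x} {y}
                      (Under-map {P = U} {flip (Sym* U)} (return ∘ inj₁) {x} {y} u)))
      step : (flip U ∪ U) ⇒ EqSteps (Sym* U)
      step (inj₁ u) = reverse (λ {x} {y} → backward {x} {y}) (post u)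
      step (inj₂ u) = Star.map (λ {x} {y} → forward {x} {y}) (post u)

    Sym*∞→⇒∞= : Sym* _∞→_ ⇒ _∞=_
    Sym*∞→⇒∞= h = let _ , W , chain = Sym*-Witnessed h in
      Sym* (⋃ Steps W) , Sym*-postFixed (⋃-postFixed Steps Steps-mono W) , chain

    →ε⇒↠∞ : _→ε_ ⇒ _↠∞_
    →ε⇒↠∞ {x} {y} r _ closed =
      closed ( (λ u v → u ≡ x × v ≡ y)
             , (λ { (refl , refl) → y , return (inj₁ r) , inj₂ (lift λ _ → refl) })
             , refl , refl)

    module _ (_≼_ : Rel (Maybe Label) ℓ₁) (≼-refl : Reflexive _≼_) (≼-trans : Transitive _≼_)
             (root-step : ∀ {x y} → x →ε y → ∀ p → lab x p ≼ lab y p) where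

      ≡⇒≼ : ∀ {c d} → c ≡ d → c ≼ d
      ≡⇒≼ refl = ≼-refl

      ∞→-labelwise : ∀ {x y} → x ∞→ y → ∀ p → lab x p ≼ lab y p
      ∞→-labelwise (S , post , h) p = related p h
        where
        mutual
          related : ∀ p {x y} → S x y → lab x p ≼ lab y p
          related p h = steps p (post h)

          steps : ∀ p {x y} → Steps S x y → lab x p ≼ lab y p
          steps p ε        = ≼-refl
          steps p {x} (_◅_ {j = m} s ss) = ≼-trans (step p {x} {m} s) (steps p ss)

          step : ∀ p {x y} → (_→ε_ ∪ Under S) x y → lab x p ≼ lab y p
          step p {x} {y} (inj₁ r) = root-step {x} {y} r p
          step [] {x} {y} (inj₂ u) = ≡⇒≼ (Under-root {Q = S} {x} {y} u)
          step (i ∷ q) {x} {y} (inj₂ u) with Under-argument {Q = S} {x} {y} u i q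
          ... | inj₁ eq = ≡⇒≼ eq
          ... | inj₂ (_ , _ , _ , _ , r) = related q r

data Zigzag : Set where
  e o : ℕ → Zigzag

next : Zigzag → Zigzag
next (e i) = o i
next (o i) = e (suc i)

data _⇝_ : Zigzag → Zigzag → Set where
  up   : ∀ i → e i ⇝ o i
  down : ∀ i → e (suc i) ⇝ o i

rank : Zigzag → ℕ
rank (e i) = i + i
rank (o i) = suc (i + i)

rank-next : ∀ u → rank (next u) ≡ suc (rank u)
rank-next (e i) = refl
rank-next (o i) = cong suc (+-suc i i)

rank-iterate : ∀ n u → rank (iterate next u n) ≡ n + rank u
rank-iterate zero    u = refl
rank-iterate (suc n) u = begin
  rank (iterate next (next u) n)  ≡⟨ rank-iterate n (next u) ⟩
  n + rank (next u)               ≡⟨ cong (n +_) (rank-next u) ⟩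
  n + suc (rank u)                ≡⟨ +-suc n (rank u) ⟩
  suc n + rank u                  ∎
  where open ≡-Reasoning

∣n-1+n∣≡1 : ∀ n → ∣ n - suc n ∣ ≡ 1
∣n-1+n∣≡1 zero    = refl
∣n-1+n∣≡1 (suc n) = ∣n-1+n∣≡1 n

⇝-rank : ∀ {u v} → u ⇝ v → ∣ rank u - rank v ∣ ≡ 1
⇝-rank (up i)   = ∣n-1+n∣≡1 (i + i)
⇝-rank (down i) = begin
  ∣ rank (next (o i)) - rank (o i) ∣      ≡⟨ cong ∣_- rank (o i) ∣ (rank-next (o i)) ⟩
  ∣ suc (rank (o i)) - rank (o i) ∣       ≡⟨ ∣-∣-comm (suc (rank (o i))) (rank (o i)) ⟩
  ∣ rank (o i) - suc (rank (o i)) ∣       ≡⟨ ∣n-1+n∣≡1 (rank (o i)) ⟩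
  1                                       ∎
  where open ≡-Reasoning

data Symbol : Set where
  f b : Symbol
  z   : Zigzag → Symbol

arity : Symbol → ℕ
arity f     = 1
arity b     = 0
arity (z _) = 1

signature : Signature
signature = record { Sym = Symbol ; ar = arity }

open Terms signature ℕ hiding (module Rewriting)
open TermProperties signature ℕ

bᵗ : T
bᵗ = constant b refl

fbᵗ : T
fbᵗ = unary f refl bᵗ

fω : T
fω = unfold id (const f) (λ _ → refl) tt

zω : T
zω = unfold id (const (z (e 0))) (λ _ → refl) tt

walk : Zigzag → T
walk = unfold next z (λ _ → refl)

z[x] : Zigzag → T
z[x] u = unary (z u) refl (var 0)

z[zω] : Zigzag → T
z[zω] u = unary (z u) refl zω

zω-unfolds : zω ≐ z[zω] (e 0)
zω-unfolds = unfold-unary id (const (z (e 0))) (λ _ → refl) tt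

zω-spine : ∀ n → lab zω (replicate n 0) ≡ ⌜ z (e 0) ⌝
zω-spine = unfold-spine id (const (z (e 0))) (λ _ → refl) tt

walk-spine : ∀ u n → lab (walk u) (replicate n 0) ≡ ⌜ z (iterate next u n) ⌝
walk-spine = unfold-spine next z (λ _ → refl)

bᵗ-ground : ∀ p {x} → lab bᵗ p ≢ just (inj₁ x)
bᵗ-ground []      ()
bᵗ-ground (_ ∷ _) ()

fω-b-free : ¬ Contains ⌜ b ⌝ fω
fω-b-free (p , hp) = no-b p hp
  where
  no-b : ∀ p → lab fω p ≢ ⌜ b ⌝
  no-b []          ()
  no-b (zero ∷ p)  = no-b p
  no-b (suc _ ∷ _) ()

𝓡-collapse : TRS
𝓡-collapse = record
  { _⟶_        = λ l r → l ≡ fbᵗ × r ≡ bᵗ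
  ; lhs-nonvar = λ { (refl , refl) x () }
  ; var-cond   = λ { (refl , refl) x (p , hp) → ⊥-elim (bᵗ-ground p hp) }
  }

module Collapse where
  open Terms.Rewriting signature ℕ 𝓡-collapse
  open Infinitary 𝓡-collapse

  fb→εb : fbᵗ →ε bᵗ
  fb→εb = fbᵗ , bᵗ , const bᵗ , (refl , refl) , fb-instance , b-instance
    where
    b-instance : ∀ p → lab bᵗ p ≡ subL (const bᵗ) (lab bᵗ) p
    b-instance p = sym (subL-constant (const bᵗ) b p)
    fb-instance : ∀ p → lab fbᵗ p ≡ subL (const bᵗ) (lab fbᵗ) p
    fb-instance p = trans (unaryLab-cong f b-instance p) (sym (subL-unary (const bᵗ) f (lab bᵗ) p))

  fω∞→b : fω ∞→ bᵗ
  fω∞→b = S , post , (λ _ → refl) , (λ _ → refl)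
    where
    S : Rel T 0ℓ
    S x y = x ≐ fω × y ≐ bᵗ
    post : S ⇒ Steps S
    post {x} {y} (x≐fω , y≐b) = begin
      x    ⟶⟨ inj₂ argument ⟩
      fbᵗ  ⟶⟨ inj₁ fb→εb ⟩
      bᵗ   ⟶⟨ inj₂ (inj₂ (lift (sym ∘ y≐b))) ⟩
      y    ∎
      where
      open StarReasoning (_→ε_ ∪ Under S)
      argument : Under S x fbᵗ
      argument = inj₁ (f , x≐fω [] , refl , λ { zero _ → (x≐fω ∘ (zero ∷_)) , (λ _ → refl)
                                              ; (suc _) (s≤s ()) })

  Has-b : T → Set
  Has-b = Contains ⌜ b ⌝

  Has-b-within : ℕ → T → Set
  Has-b-within = ContainsWithin ⌜ b ⌝

  root-step-b : ∀ {x y} → x →ε y → (∀ n → Has-b-within n y) × Has-b x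
  root-step-b (_ , _ , _ , (refl , refl) , ex , ey) = (λ _ → [] , z≤n , ey []) , (zero ∷ [] , ex (zero ∷ []))

  -- Reflecting b is proved by induction on the depth of the b in the result; this is where ↠∞
  -- differs from ∞→, which has fω ∞→ b.
  Preserves-b : Rel T 1ℓ
  Preserves-b s t = Lift 1ℓ ((∀ n → Has-b-within n s → Has-b-within n t) × (Has-b t → Has-b s))

  Steps-b-within : ∀ n {x y} → Steps Preserves-b x y → Has-b-within n x → Has-b-within n y
  Steps-b-within n ε                 = id
  Steps-b-within n {x} (_◅_ {j = m} (inj₁ r) ss) =
    λ _ → Steps-b-within n ss (proj₁ (root-step-b {x} {m} r) n)
  Steps-b-within n {x} (_◅_ {j = m} (inj₂ u) ss) = Steps-b-within n ss ∘ under n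
    where
    under : ∀ n → Has-b-within n x → Has-b-within n m
    under zero    = Under-within₀ ⌜ b ⌝ {Q = Preserves-b} {x} {m} u
    under (suc n) = Under-within ⌜ b ⌝ {Q = Preserves-b} (λ pr → proj₁ (lower pr) n) {x} {m} u

  Steps-b⁻¹ : ∀ {x y} → Steps Preserves-b x y → Has-b y → Has-b x
  Steps-b⁻¹ ε                 = id
  Steps-b⁻¹ {x} (_◅_ {j = m} (inj₁ r) _) = λ _ → proj₂ (root-step-b {x} {m} r)
  Steps-b⁻¹ {x} (_◅_ {j = m} (inj₂ u) ss) =
    Under-contains⁻¹ ⌜ b ⌝ {Q = Preserves-b} (proj₂ ∘ lower) {x} {m} u ∘ Steps-b⁻¹ ss

  module _ {S : Rel T 0ℓ} (post : S ⇒ (Steps Preserves-b ⨾ Under S)) where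

    postFixed-b-within : ∀ n {x y} → S x y → Has-b-within n x → Has-b-within n y
    postFixed-b-within zero {y = y} s with post s
    ... | m , ss , u = Under-within₀ ⌜ b ⌝ {Q = S} {m} {y} u ∘ Steps-b-within zero ss
    postFixed-b-within (suc n) {y = y} s with post s
    ... | m , ss , u =
      Under-within ⌜ b ⌝ {Q = S} (postFixed-b-within n) {m} {y} u ∘ Steps-b-within (suc n) ss

    postFixed-b-within⁻¹ : ∀ n {x y} → S x y → Has-b-within n y → Has-b x
    postFixed-b-within⁻¹ zero {y = y} s with post s
    ... | m , ss , u = Steps-b⁻¹ ss ∘ Under-within₀⁻¹ ⌜ b ⌝ {Q = S} {m} {y} u
    postFixed-b-within⁻¹ (suc n) {y = y} s with post s
    ... | m , ss , u =
      Steps-b⁻¹ ss ∘ Under-within⁻¹ ⌜ b ⌝ {Q = S} (postFixed-b-within⁻¹ n) {m} {y} u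

  ↠∞-preserves-b : _↠∞_ ⇒ Preserves-b
  ↠∞-preserves-b h = h Preserves-b λ {x} {y} (S , post , s) →
    lift ( (λ n → postFixed-b-within {S = S} post n {x} {y} s)
         , λ (p , hp) → postFixed-b-within⁻¹ {S = S} post (length p) {x} {y} s (p , ≤-refl , hp))

  Sym*↠∞-b⁻¹ : ∀ {x y} → Sym* _↠∞_ x y → Has-b y → Has-b x
  Sym*↠∞-b⁻¹ ε = id
  Sym*↠∞-b⁻¹ {x} (_◅_ {j = m} (inj₁ h) hs) = forward ∘ Sym*↠∞-b⁻¹ hs
    where
    forward : Has-b m → Has-b x
    forward (p , hp) with proj₁ (lower (↠∞-preserves-b h)) (length p) (p , ≤-refl , hp)
    ... | q , _ , hq = q , hq
  Sym*↠∞-b⁻¹ (inj₂ h ◅ hs) = proj₂ (lower (↠∞-preserves-b h)) ∘ Sym*↠∞-b⁻¹ hs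

  ¬fω-Sym*↠∞-b : ¬ Sym* _↠∞_ fω bᵗ
  ¬fω-Sym*↠∞-b hs = fω-b-free (Sym*↠∞-b⁻¹ hs ([] , refl))

data ZigzagRule : T → T → Set where
  rule : ∀ {u v} → u ⇝ v → ZigzagRule (z[x] u) (z[x] v)

𝓡-zigzag : TRS
𝓡-zigzag = record
  { _⟶_        = ZigzagRule
  ; lhs-nonvar = λ { (rule _) x () }
  ; var-cond   = λ { (rule _) x ([] , ())
                   ; (rule _) x (zero ∷ q , hq) → zero ∷ q , hq
                   ; (rule _) x (suc _ ∷ _ , ()) }
  }

data _≼_ : Rel (Maybe Label) 0ℓ where
  stay : ∀ {c} → c ≼ c
  move : ∀ {u v} → u ⇝ v → ⌜ z u ⌝ ≼ ⌜ z v ⌝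

-- Every ⇝-step ends in some o i, where no ⇝-step starts.
≼-trans : Transitive _≼_
≼-trans stay            d        = d
≼-trans c               stay     = c
≼-trans (move (up _))   (move ())
≼-trans (move (down _)) (move ())

rankL : Maybe Label → ℕ
rankL (just (inj₂ (z u))) = rank u
rankL _                   = 0

≼-rank : ∀ {c d} → c ≼ d → ∣ rankL c - rankL d ∣ ≤ 1
≼-rank {c} stay = subst (_≤ 1) (sym (∣n-n∣≡0 (rankL c))) z≤n
≼-rank (move u⇝v) = ≤-reflexive (⇝-rank u⇝v)

module ZigzagExample where
  open Terms.Rewriting signature ℕ 𝓡-zigzag
  open Infinitary 𝓡-zigzag

  z-step : ∀ {u v} → u ⇝ v → z[zω] u →ε z[zω] v
  z-step {u} {v} u⇝v = z[x] u , z[x] v , const zω , rule u⇝v , instantiate u , instantiate v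
    where
    instantiate : ∀ w p → lab (z[zω] w) p ≡ subL (const zω) (lab (z[x] w)) p
    instantiate w p = sym (subL-unary (const zω) (z w) (leafLab (inj₁ 0)) p)

  root-step-≼ : ∀ {x y} → x →ε y → ∀ p → lab x p ≼ lab y p
  root-step-≼ (_ , _ , _ , rule u⇝v , ex , ey) [] rewrite ex [] | ey [] = move u⇝v
  root-step-≼ (_ , _ , _ , rule _ , ex , ey) p@(zero ∷ _)  = subst₂ _≼_ (sym (ex p)) (sym (ey p)) stay
  root-step-≼ (_ , _ , _ , rule _ , ex , ey) p@(suc _ ∷ _) = subst₂ _≼_ (sym (ex p)) (sym (ey p)) stay

  ∞→-≼ : ∀ {x y} → x ∞→ y → ∀ p → lab x p ≼ lab y p
  ∞→-≼ = ∞→-labelwise _≼_ stay ≼-trans (λ {x} {y} → root-step-≼ {x} {y})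

  e0↠∞o0 : z[zω] (e 0) ↠∞ z[zω] (o 0)
  e0↠∞o0 = →ε⇒↠∞ (z-step (up 0))

  ¬o0∞→e0 : ¬ (z[zω] (o 0) ∞→ z[zω] (e 0))
  ¬o0∞→e0 h with ∞→-≼ h []
  ... | move ()

  ¬o0↠∞e0 : ¬ (z[zω] (o 0) ↠∞ z[zω] (e 0))
  ¬o0↠∞e0 = ¬o0∞→e0 ∘ ↠∞⇒∞→

  Sym*∞→-rank-bounded : ∀ {x y} → Sym* _∞→_ x y → ∃[ k ] ∀ p → ∣ rankL (lab x p) - rankL (lab y p) ∣ ≤ k
  Sym*∞→-rank-bounded {x} ε = 0 , λ p → ≤-reflexive (∣n-n∣≡0 (rankL (lab x p)))
  Sym*∞→-rank-bounded {x} {y} (_◅_ {j = m} h hs) =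
    let k , near = Sym*∞→-rank-bounded hs in
    suc k , λ p → ≤-trans (∣-∣-triangle (rankL (lab x p)) (rankL (lab m p)) (rankL (lab y p)))
                          (+-mono-≤ (one-step h p) (near p))
    where
    one-step : (flip _∞→_ ∪ _∞→_) x m → ∀ p → ∣ rankL (lab x p) - rankL (lab m p) ∣ ≤ 1
    one-step (inj₁ h) p = subst (_≤ 1) (∣-∣-comm (rankL (lab m p)) _) (≼-rank (∞→-≼ h p))
    one-step (inj₂ h) p = ≼-rank (∞→-≼ h p)

  ¬zω-Sym*∞→-walk : ¬ Sym* _∞→_ zω (walk (e 0))
  ¬zω-Sym*∞→-walk hs =
    let k , near = Sym*∞→-rank-bounded hs in
    1+n≰n (subst (_≤ k) (distance (suc k)) (near (replicate (suc k) 0)))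
    where
    distance : ∀ n → ∣ rankL (lab zω (replicate n 0)) - rankL (lab (walk (e 0)) (replicate n 0)) ∣ ≡ n
    distance n = begin
      ∣ rankL (lab zω (replicate n 0)) - rankL (lab (walk (e 0)) (replicate n 0)) ∣
        ≡⟨ cong₂ (λ c d → ∣ rankL c - rankL d ∣) (zω-spine n) (walk-spine (e 0) n) ⟩
      rank (iterate next (e 0) n)
        ≡⟨ rank-iterate n (e 0) ⟩
      n + 0
        ≡⟨ +-identityʳ n ⟩
      n ∎
      where open ≡-Reasoning

  mutual
    chain-e : (R : Rel T ℓ₁) → ∀ i → EqSteps R (z[zω] (e 0)) (z[zω] (e i))
    chain-e R zero    = ε
    chain-e R (suc i) = chain-o R i ◅◅ return (inj₁ (z-step (down i)))

    chain-o : (R : Rel T ℓ₁) → ∀ i → EqSteps R (z[zω] (e 0)) (z[zω] (o i))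
    chain-o R i = chain-e R i ◅◅ return (inj₂ (inj₁ (z-step (up i))))

  zigzag-chain : (R : Rel T ℓ₁) → ∀ u → EqSteps R (z[zω] (e 0)) (z[zω] u)
  zigzag-chain R (e i) = chain-e R i
  zigzag-chain R (o i) = chain-o R i

  zω∞=walk : zω ∞= walk (e 0)
  zω∞=walk = S , post , e 0 , (λ _ → refl) , (λ _ → refl)
    where
    S : Rel T 0ℓ
    S x y = ∃[ u ] (x ≐ zω × y ≐ walk u)
    post : S ⇒ EqSteps S
    post {x} {y} (u , x≐zω , y≐walk) = begin
      x            ⟶⟨ inj₂ (inj₂ (inj₂ (lift λ p → trans (x≐zω p) (zω-unfolds p)))) ⟩
      z[zω] (e 0)  ⟶*⟨ zigzag-chain S u ⟩
      z[zω] u      ⟶⟨ inj₂ (inj₂ (inj₁ (z u , refl , y≐walk [] , arguments))) ⟩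
      y            ∎
      where
      open StarReasoning (_←ε_ ∪ _→ε_ ∪ Under S)
      arguments : ∀ i (lt : i < 1) →
                  S (child (z[zω] u) (z u) refl i lt) (child y (z u) (y≐walk []) i lt)
      arguments zero    _         = next u , (λ _ → refl) , y≐walk ∘ (zero ∷_)
      arguments (suc _) (s≤s ())

ℕ-infinite : Infinite ℕ
ℕ-infinite = id , id

theorem7p2 : ((Sig : Signature) (X : Set) → Infinite X → (𝓡 : Terms.TRS Sig X) →
      let open Terms Sig X in let open Rewriting 𝓡 in
        (_↠∞_ ⇒ _∞→_)
      × (_↠∞_ ⇒ Sym* _↠∞_)
      × (_∞→_ ⇒ Sym* _∞→_)
      × (Sym* _↠∞_ ⇒ Sym* _∞→_)
      × (Sym* _∞→_ ⇒ _∞=_))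
    × (Σ[ Sig ∈ Signature ] Σ[ X ∈ Set ] (Infinite X × Σ[ 𝓡 ∈ Terms.TRS Sig X ]
        (let open Terms Sig X in let open Rewriting 𝓡 in _↠∞_ ⊂ _∞→_)))
    × (Σ[ Sig ∈ Signature ] Σ[ X ∈ Set ] (Infinite X × Σ[ 𝓡 ∈ Terms.TRS Sig X ]
        (let open Terms Sig X in let open Rewriting 𝓡 in _↠∞_ ⊂ Sym* _↠∞_)))
    × (Σ[ Sig ∈ Signature ] Σ[ X ∈ Set ] (Infinite X × Σ[ 𝓡 ∈ Terms.TRS Sig X ]
        (let open Terms Sig X in let open Rewriting 𝓡 in _∞→_ ⊂ Sym* _∞→_)))
    × (Σ[ Sig ∈ Signature ] Σ[ X ∈ Set ] (Infinite X × Σ[ 𝓡 ∈ Terms.TRS Sig X ]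
        (let open Terms Sig X in let open Rewriting 𝓡 in Sym* _↠∞_ ⊂ Sym* _∞→_)))
    × (Σ[ Sig ∈ Signature ] Σ[ X ∈ Set ] (Infinite X × Σ[ 𝓡 ∈ Terms.TRS Sig X ]
        (let open Terms Sig X in let open Rewriting 𝓡 in Sym* _∞→_ ⊂ _∞=_)))
theorem7p2 =
    (λ Sig X _ 𝓡 → let open TermProperties.Infinitary Sig X 𝓡 in
       ↠∞⇒∞→ , Sym*-return , Sym*-return , Sym*-mono ↠∞⇒∞→ , Sym*∞→⇒∞=)
  , (signature , ℕ , ℕ-infinite , 𝓡-collapse ,
       C.↠∞⇒∞→ , fω , bᵗ , fω∞→b , ¬fω-Sym*↠∞-b ∘ Sym*-return)
  , (signature , ℕ , ℕ-infinite , 𝓡-zigzag ,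
       Sym*-return , z[zω] (o 0) , z[zω] (e 0) , return (inj₁ e0↠∞o0) , ¬o0↠∞e0)
  , (signature , ℕ , ℕ-infinite , 𝓡-zigzag ,
       Sym*-return , z[zω] (o 0) , z[zω] (e 0) , return (inj₁ (Z.↠∞⇒∞→ e0↠∞o0)) , ¬o0∞→e0)
  , (signature , ℕ , ℕ-infinite , 𝓡-collapse ,
       Sym*-mono C.↠∞⇒∞→ , fω , bᵗ , Sym*-return fω∞→b , ¬fω-Sym*↠∞-b)
  , (signature , ℕ , ℕ-infinite , 𝓡-zigzag ,
       Z.Sym*∞→⇒∞= , zω , walk (e 0) , zω∞=walk , ¬zω-Sym*∞→-walk)
  where
  open Collapse
  open ZigzagExample
  module C = Infinitary 𝓡-collapse
  module Z = Infinitary 𝓡-zigzag
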